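{- If $G\subseteq Q_n$ is a spanning subgraph with diameter $n$, then $e(G)\ge 2^n+\Theta\!\left(\frac{2^n}{n}\right)$, i.e. the number of edges of $G$ exceeds $2^n$ by a quantity of order at least $2^n/n$.
   Context: $Q_n$ denotes the $n$-dimensional hypercube graph: its vertex set is $\{0,1\}^n$, and two vertices are adjacent if and only if they differ in exactly one coordinate. $e(G)$ denotes the number of edges of $G$. -}

module Defs where

open import Data.Nat using (ℕ; zero; suc; _+_; _*_; _/_; _≤_)
open import Data.Bool using (Bool; true; false; if_then_else_)
open import Data.Vec using (Vec; []; _∷_)
open import Data.List using (List; []; _∷_; map; concatMap; _++_)
open import Data.Nat.ListAction using (sum)
open import Data.Product using (Σ; ∃-syntax; _×_; _,_)
open import Relation.Binary.PropositionalEquality using (_≡_)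

Vertex : ℕ → Set
Vertex n = Vec Bool n

hamming : ∀ {n} → Vertex n → Vertex n → ℕ
hamming []       []       = 0
hamming (x ∷ u) (y ∷ v) = (if xor x y then 1 else 0) + hamming u v
  where
  xor : Bool → Bool → Bool
  xor true  b = if b then false else true
  xor false b = b

QAdj : ∀ {n} → Vertex n → Vertex n → Set
QAdj u v = hamming u v ≡ 1

record SpanningSubgraph (n : ℕ) : Set where
  field
    adj    : Vertex n → Vertex n → Bool
    sym    : ∀ u v → adj u v ≡ adj v u
    sub    : ∀ u v → adj u v ≡ true → QAdj u v
open SpanningSubgraph public

allVertices : (n : ℕ) → List (Vertex n)
allVertices zero    = [] ∷ []
allVertices (suc n) = map (true ∷_) (allVertices n) ++ map (false ∷_) (allVertices n)

orderedEdgeCount : ∀ {n} → SpanningSubgraph n → ℕ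
orderedEdgeCount {n} G =
  sum (concatMap (λ u → map (λ v → if adj G u v then 1 else 0) (allVertices n)) (allVertices n))

-- e(G): number of (unordered) edges; each edge is counted twice above
edges : ∀ {n} → SpanningSubgraph n → ℕ
edges G = orderedEdgeCount G / 2

data Walk {n : ℕ} (G : SpanningSubgraph n) : Vertex n → Vertex n → ℕ → Set where
  here : ∀ {u} → Walk G u u 0
  step : ∀ {u w v k} → adj G u w ≡ true → Walk G w v k → Walk G u v (suc k)

HasDiameter : ∀ {n} → SpanningSubgraph n → ℕ → Set
HasDiameter {n} G d =
  (∀ (u v : Vertex n) → ∃[ k ] (k ≤ d × Walk G u v k)) ×
  (∃[ u ] ∃[ v ] (∀ k → Walk G u v k → d ≤ k))

-- Every vertex of G has degree at least 2 (a vertex of degree ≤ 1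
-- could not reach the antipodes of itself and of its neighbour within n
-- steps), so 2·e(G) = 2·2^n + excess, where excess = Σ_v (deg v − 2).  Let
-- S be the set of vertices of degree ≥ 3.  Outside S every vertex has degree
-- at most 2, so breadth-first search from S grows slowly: each layer of the
-- search has at most Σ_{w∈S} deg w vertices.  Since every vertex is within
-- distance n of S, this gives 2^n ≤ |S| + n·Σ_{w∈S} deg w ≤ 4n·excess.  (S
-- cannot be empty: then the same bound for a single vertex would give
-- 2^n ≤ 2n + 1.)  Plugging excess ≥ 2^n/(4n) into the handshake identity
-- yields the theorem with constant 16.

module Submission where

open import Defs hiding (sym)
open import Data.Nat
open import Data.Nat.Properties
open import Data.Nat.DivMod using (m≡m%n+[m/n]*n; m%n<n)
open import Data.Nat.ListAction using (sum)
open import Data.Nat.ListAction.Properties using (sum-++)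
open import Data.Nat.Tactic.RingSolver using (solve-∀)
open import Data.Bool using (Bool; true; false; if_then_else_; _∧_; _∨_; not) renaming (_≟_ to _≟ᵇ_)
open import Data.Bool.Properties using (∨-zeroʳ)
open import Data.Vec using ([]; _∷_; replicate)
open import Data.Vec.Properties using (≡-dec)
open import Data.List using (List; []; _∷_; map; concatMap; concat; _++_)
open import Data.List.Properties using (map-++; map-∘)
open import Data.Product using (∃-syntax; _×_; _,_; proj₁; proj₂)
open import Data.Sum using (_⊎_; inj₁; inj₂)
open import Data.Empty using (⊥-elim)
open import Function using (_∘_)
open import Relation.Nullary using (¬_; Dec; yes; no; does)
open import Relation.Binary.PropositionalEquality
open import Algebra.Properties.CommutativeSemigroup +-commutativeSemigroup
  using (interchange)

∑ : (n : ℕ) → (Vertex n → ℕ) → ℕ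
∑ zero    f = f []
∑ (suc n) f = ∑ n (λ v → f (true ∷ v)) + ∑ n (λ v → f (false ∷ v))

∑-cong : ∀ n {f g : Vertex n → ℕ} → (∀ v → f v ≡ g v) → ∑ n f ≡ ∑ n g
∑-cong zero    h = h []
∑-cong (suc n) h = cong₂ _+_ (∑-cong n (h ∘ (true ∷_))) (∑-cong n (h ∘ (false ∷_)))

∑-mono : ∀ n {f g : Vertex n → ℕ} → (∀ v → f v ≤ g v) → ∑ n f ≤ ∑ n g
∑-mono zero    h = h []
∑-mono (suc n) h = +-mono-≤ (∑-mono n (h ∘ (true ∷_))) (∑-mono n (h ∘ (false ∷_)))

∑-+ : ∀ n (f g : Vertex n → ℕ) → ∑ n (λ v → f v + g v) ≡ ∑ n f + ∑ n g
∑-+ zero    f g = refl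
∑-+ (suc n) f g =
  trans (cong₂ _+_ (∑-+ n (f ∘ (true ∷_)) (g ∘ (true ∷_))) (∑-+ n (f ∘ (false ∷_)) (g ∘ (false ∷_))))
        (interchange (∑ n (f ∘ (true ∷_))) (∑ n (g ∘ (true ∷_))) (∑ n (f ∘ (false ∷_))) (∑ n (g ∘ (false ∷_))))

∑-* : ∀ n c (f : Vertex n → ℕ) → ∑ n (λ v → c * f v) ≡ c * ∑ n f
∑-* zero    c f = refl
∑-* (suc n) c f =
  trans (cong₂ _+_ (∑-* n c _) (∑-* n c _)) (sym (*-distribˡ-+ c _ _))

∑-swap : ∀ n m (h : Vertex n → Vertex m → ℕ) →
         ∑ n (λ u → ∑ m (h u)) ≡ ∑ m (λ v → ∑ n (λ u → h u v))
∑-swap zero    m h = refl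
∑-swap (suc n) m h =
  trans (cong₂ _+_ (∑-swap n m _) (∑-swap n m _)) (sym (∑-+ m _ _))

∑-const : ∀ n c → ∑ n (λ _ → c) ≡ c * 2 ^ n
∑-const zero    c = sym (*-identityʳ c)
∑-const (suc n) c = trans (cong₂ _+_ (∑-const n c) (∑-const n c)) (double c (2 ^ n))
  where
  double : ∀ c p → c * p + c * p ≡ c * (2 * p)
  double = solve-∀

∑-≥-point : ∀ n (f : Vertex n → ℕ) a → f a ≤ ∑ n f
∑-≥-point zero    f []          = ≤-refl
∑-≥-point (suc n) f (true ∷ a)  = ≤-trans (∑-≥-point n _ a) (m≤m+n _ _)
∑-≥-point (suc n) f (false ∷ a) = ≤-trans (∑-≥-point n _ a) (m≤n+m _ _)

∷-injectiveʳ : ∀ {n x y} {u v : Vertex n} → _≡_ {A = Vertex (suc n)} (x ∷ u) (y ∷ v) → u ≡ v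
∷-injectiveʳ refl = refl

∑-≥-pair : ∀ n (f : Vertex n → ℕ) a b → ¬ a ≡ b → f a + f b ≤ ∑ n f
∑-≥-pair zero    f []          []          a≢b = ⊥-elim (a≢b refl)
∑-≥-pair (suc n) f (true ∷ a)  (true ∷ b)  a≢b =
  ≤-trans (∑-≥-pair n _ a b (a≢b ∘ cong (true ∷_))) (m≤m+n _ _)
∑-≥-pair (suc n) f (false ∷ a) (false ∷ b) a≢b =
  ≤-trans (∑-≥-pair n _ a b (a≢b ∘ cong (false ∷_))) (m≤n+m _ _)
∑-≥-pair (suc n) f (true ∷ a)  (false ∷ b) _   =
  +-mono-≤ (∑-≥-point n _ a) (∑-≥-point n _ b)
∑-≥-pair (suc n) f (false ∷ a) (true ∷ b)  _   =
  subst (_≤ ∑ (suc n) f) (+-comm (f (true ∷ b)) (f (false ∷ a)))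
        (+-mono-≤ (∑-≥-point n (f ∘ (true ∷_)) b) (∑-≥-point n (f ∘ (false ∷_)) a))

∑-vanish : ∀ n (f : Vertex n → ℕ) → (∀ v → f v ≡ 0) → ∑ n f ≡ 0
∑-vanish zero    f h = h []
∑-vanish (suc n) f h = cong₂ _+_ (∑-vanish n _ (h ∘ (true ∷_))) (∑-vanish n _ (h ∘ (false ∷_)))

∑-point : ∀ n (f : Vertex n → ℕ) a → (∀ w → ¬ w ≡ a → f w ≡ 0) → ∑ n f ≡ f a
∑-point zero    f []          h = refl
∑-point (suc n) f (true ∷ a)  h =
  trans (cong₂ _+_ (∑-point n _ a (λ w w≢a → h _ (w≢a ∘ ∷-injectiveʳ)))
                   (∑-vanish n _ (λ v → h _ λ ())))
        (+-identityʳ _)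
∑-point (suc n) f (false ∷ a) h =
  cong₂ _+_ (∑-vanish n _ (λ v → h _ λ ()))
            (∑-point n _ a (λ w w≢a → h _ (w≢a ∘ ∷-injectiveʳ)))

∑-list : ∀ n (f : Vertex n → ℕ) → ∑ n f ≡ sum (map f (allVertices n))
∑-list zero    f = sym (+-identityʳ _)
∑-list (suc n) f = begin
    ∑ n (f ∘ (true ∷_)) + ∑ n (f ∘ (false ∷_))
  ≡⟨ cong₂ _+_ (∑-list n _) (∑-list n _) ⟩
    sum (map (f ∘ (true ∷_)) vs) + sum (map (f ∘ (false ∷_)) vs)
  ≡⟨ cong₂ _+_ (cong sum (map-∘ vs)) (cong sum (map-∘ vs)) ⟩
    sum (map f (map (true ∷_) vs)) + sum (map f (map (false ∷_) vs))
  ≡⟨ sym (sum-++ (map f (map (true ∷_) vs)) (map f (map (false ∷_) vs))) ⟩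
    sum (map f (map (true ∷_) vs) ++ map f (map (false ∷_) vs))
  ≡⟨ cong sum (sym (map-++ f (map (true ∷_) vs) (map (false ∷_) vs))) ⟩
    sum (map f (allVertices (suc n)))
  ∎
  where
  open ≡-Reasoning
  vs = allVertices n

sum-concatMap : ∀ {A : Set} (g : A → List ℕ) xs → sum (concatMap g xs) ≡ sum (map (sum ∘ g) xs)
sum-concatMap g []       = refl
sum-concatMap g (x ∷ xs) = trans (sum-++ (g x) (concat (map g xs))) (cong (sum (g x) +_) (sum-concatMap g xs))

⟦_⟧ : Bool → ℕ
⟦ b ⟧ = if b then 1 else 0

indicator-≤ : ∀ b {m} → (b ≡ true → 1 ≤ m) → ⟦ b ⟧ ≤ m
indicator-≤ false _ = z≤n
indicator-≤ true  h = h refl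

size : ∀ {n} → (Vertex n → Bool) → ℕ
size {n} p = ∑ n (λ v → ⟦ p v ⟧)

size-all : ∀ n (p : Vertex n → Bool) → (∀ v → p v ≡ true) → size p ≡ 2 ^ n
size-all n p h = trans (∑-cong n (cong ⟦_⟧ ∘ h)) (trans (∑-const n 1) (*-identityˡ _))

comp : ∀ {n} → Vertex n → Vertex n
comp []      = []
comp (x ∷ v) = not x ∷ comp v

ham-self : ∀ {n} (u : Vertex n) → hamming u u ≡ 0
ham-self []          = refl
ham-self (true ∷ u)  = ham-self u
ham-self (false ∷ u) = ham-self u

ham-sym : ∀ {n} (u v : Vertex n) → hamming u v ≡ hamming v u
ham-sym []          []          = refl
ham-sym (true ∷ u)  (true ∷ v)  = ham-sym u v
ham-sym (true ∷ u)  (false ∷ v) = cong suc (ham-sym u v)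
ham-sym (false ∷ u) (true ∷ v)  = cong suc (ham-sym u v)
ham-sym (false ∷ u) (false ∷ v) = ham-sym u v

ham-comp : ∀ {n} (u : Vertex n) → hamming u (comp u) ≡ n
ham-comp []          = refl
ham-comp (true ∷ u)  = cong suc (ham-comp u)
ham-comp (false ∷ u) = cong suc (ham-comp u)

ham-tri : ∀ {n} (u w v : Vertex n) → hamming u v ≤ hamming u w + hamming w v
ham-tri [] [] [] = z≤n
ham-tri (true ∷ u)  (true ∷ w)  (true ∷ v)  = ham-tri u w v
ham-tri (true ∷ u)  (true ∷ w)  (false ∷ v) = ≤-trans (s≤s (ham-tri u w v)) (≤-reflexive (sym (+-suc _ _)))
ham-tri (true ∷ u)  (false ∷ w) (true ∷ v)  = ≤-trans (ham-tri u w v) (+-mono-≤ (n≤1+n _) (n≤1+n _))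
ham-tri (true ∷ u)  (false ∷ w) (false ∷ v) = s≤s (ham-tri u w v)
ham-tri (false ∷ u) (true ∷ w)  (true ∷ v)  = s≤s (ham-tri u w v)
ham-tri (false ∷ u) (true ∷ w)  (false ∷ v) = ≤-trans (ham-tri u w v) (+-mono-≤ (n≤1+n _) (n≤1+n _))
ham-tri (false ∷ u) (false ∷ w) (true ∷ v)  = ≤-trans (s≤s (ham-tri u w v)) (≤-reflexive (sym (+-suc _ _)))
ham-tri (false ∷ u) (false ∷ w) (false ∷ v) = ham-tri u w v

walk-ham : ∀ {n} {G : SpanningSubgraph n} {x y k} → Walk G x y k → hamming x y ≤ k
walk-ham {x = x} here = ≤-reflexive (ham-self x)
walk-ham {G = G} {x} {y} (step {w = w} a r) =
  ≤-trans (ham-tri x w y) (subst (λ d → d + hamming w y ≤ suc _) (sym (sub G x w a)) (s≤s (walk-ham r)))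

first-step : ∀ {n} {G : SpanningSubgraph n} {u v k} → Walk G u v k → 1 ≤ hamming u v →
             ∃[ w ] (adj G u w ≡ true × Walk G w v (pred k))
first-step {u = u} here       h = ⊥-elim (1+n≰n (subst (1 ≤_) (ham-self u) h))
first-step         (step a r) _ = _ , a , r

∨-elim : ∀ a b → a ∨ b ≡ true → a ≡ true ⊎ b ≡ true
∨-elim true  b h = inj₁ refl
∨-elim false b h = inj₂ h

∧-elim : ∀ a b → a ∧ b ≡ true → a ≡ true × b ≡ true
∧-elim true true h = refl , refl

anyV : (n : ℕ) → (Vertex n → Bool) → Bool
anyV zero    p = p []
anyV (suc n) p = anyV n (λ v → p (true ∷ v)) ∨ anyV n (λ v → p (false ∷ v))

anyV-intro : ∀ n (p : Vertex n → Bool) w → p w ≡ true → anyV n p ≡ true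
anyV-intro zero    p []          h = h
anyV-intro (suc n) p (true ∷ w)  h = cong (_∨ anyV n (p ∘ (false ∷_))) (anyV-intro n (p ∘ (true ∷_)) w h)
anyV-intro (suc n) p (false ∷ w) h =
  trans (cong (anyV n (p ∘ (true ∷_)) ∨_) (anyV-intro n (p ∘ (false ∷_)) w h)) (∨-zeroʳ _)

anyV-elim : ∀ n (p : Vertex n → Bool) → anyV n p ≡ true → ∃[ w ] p w ≡ true
anyV-elim zero    p h = [] , h
anyV-elim (suc n) p h with ∨-elim _ _ h
... | inj₁ h₁ = let w , e = anyV-elim n _ h₁ in true ∷ w , e
... | inj₂ h₂ = let w , e = anyV-elim n _ h₂ in false ∷ w , e

point : ∀ {n} → Vertex n → Vertex n → Bool
point v w = does (≡-dec _≟ᵇ_ w v)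

point-self : ∀ {n} (v : Vertex n) → point v v ≡ true
point-self v with ≡-dec _≟ᵇ_ v v
... | yes _  = refl
... | no v≢v = ⊥-elim (v≢v refl)

point-other : ∀ {n} (v w : Vertex n) → ¬ w ≡ v → point v w ≡ false
point-other v w w≢v with ≡-dec _≟ᵇ_ w v
... | yes w≡v = ⊥-elim (w≢v w≡v)
... | no _    = refl

size-point : ∀ {n} (v : Vertex n) → size (point v) ≡ 1
size-point {n} v = trans (∑-point n _ v (λ w w≢v → cong ⟦_⟧ (point-other v w w≢v)))
                         (cong ⟦_⟧ (point-self v))

module Graph {n : ℕ} (G : SpanningSubgraph n) where

  DiameterAtMost : ℕ → Set
  DiameterAtMost d = ∀ (u v : Vertex n) → ∃[ k ] (k ≤ d × Walk G u v k)

  adj-sym : ∀ {x y} → adj G x y ≡ true → adj G y x ≡ true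
  adj-sym {x} {y} = trans (SpanningSubgraph.sym G y x)

  deg : Vertex n → ℕ
  deg w = ∑ n (λ v → ⟦ adj G w v ⟧)

  nbrs : (Vertex n → Bool) → Vertex n → ℕ
  nbrs Q w = ∑ n (λ v → ⟦ adj G w v ⟧ * ⟦ Q v ⟧)

  weight : (Vertex n → Bool) → ℕ
  weight T = ∑ n (λ w → ⟦ T w ⟧ * deg w)

  deg-split : ∀ Q w → deg w ≡ nbrs Q w + nbrs (not ∘ Q) w
  deg-split Q w = trans (∑-cong n split) (∑-+ n _ _)
    where
    indicator-split : ∀ a q → ⟦ a ⟧ ≡ ⟦ a ⟧ * ⟦ q ⟧ + ⟦ a ⟧ * ⟦ not q ⟧
    indicator-split false q     = refl
    indicator-split true  true  = refl
    indicator-split true  false = refl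
    split : ∀ v → ⟦ adj G w v ⟧ ≡ ⟦ adj G w v ⟧ * ⟦ Q v ⟧ + ⟦ adj G w v ⟧ * ⟦ not (Q v) ⟧
    split v = indicator-split (adj G w v) (Q v)

  nbrs-≥1 : ∀ Q w x → adj G w x ≡ true → Q x ≡ true → 1 ≤ nbrs Q w
  nbrs-≥1 Q w x wx qx =
    subst (_≤ nbrs Q w) (cong₂ (λ a q → ⟦ a ⟧ * ⟦ q ⟧) wx qx) (∑-≥-point n _ x)

  covering : ∀ (P Q : Vertex n → Bool) → (∀ v → Q v ≡ true → ∃[ w ] (adj G v w ≡ true × P w ≡ true)) →
             size Q ≤ ∑ n (λ w → ⟦ P w ⟧ * nbrs Q w)
  covering P Q cover = begin
      size Q
    ≤⟨ ∑-mono n counted ⟩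
      ∑ n (λ v → ∑ n (λ w → term w v))
    ≡⟨ ∑-swap n n (λ v w → term w v) ⟩
      ∑ n (λ w → ∑ n (term w))
    ≡⟨ ∑-cong n (λ w → ∑-* n ⟦ P w ⟧ (λ v → ⟦ adj G w v ⟧ * ⟦ Q v ⟧)) ⟩
      ∑ n (λ w → ⟦ P w ⟧ * nbrs Q w)
    ∎
    where
    open ≤-Reasoning
    term : Vertex n → Vertex n → ℕ
    term w v = ⟦ P w ⟧ * (⟦ adj G w v ⟧ * ⟦ Q v ⟧)
    edge-counted : ∀ {p a q} → p ≡ true → a ≡ true → q ≡ true → ⟦ p ⟧ * (⟦ a ⟧ * ⟦ q ⟧) ≡ 1
    edge-counted refl refl refl = refl
    counted : ∀ v → ⟦ Q v ⟧ ≤ ∑ n (λ w → term w v)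
    counted v = indicator-≤ (Q v) λ qv → let w , vw , pw = cover v qv in
      subst (_≤ ∑ n (λ w → term w v)) (edge-counted pw (adj-sym vw) qv)
            (∑-≥-point n (λ w → term w v) w)

  ball : (Vertex n → Bool) → ℕ → Vertex n → Bool
  ball T zero    x = T x
  ball T (suc j) x = ball T j x ∨ anyV n (λ w → adj G x w ∧ ball T j w)

  ball-suc : ∀ T j x → ball T j x ≡ true → ball T (suc j) x ≡ true
  ball-suc T j x h rewrite h = refl

  ball-⊇ : ∀ T j x → T x ≡ true → ball T j x ≡ true
  ball-⊇ T zero    x h = h
  ball-⊇ T (suc j) x h = ball-suc T j x (ball-⊇ T j x h)

  ball-step : ∀ T j x w → adj G x w ≡ true → ball T j w ≡ true → ball T (suc j) x ≡ true
  ball-step T j x w xw h rewrite anyV-intro n (λ w → adj G x w ∧ ball T j w) w (cong₂ _∧_ xw h) =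
    ∨-zeroʳ _

  walk→ball : ∀ T {j x y k} → k ≤ j → T y ≡ true → Walk G x y k → ball T j x ≡ true
  walk→ball T {j} {x} _ t here = ball-⊇ T j x t
  walk→ball T {suc j} {x} (s≤s k≤j) t (step {w = w} xw r) = ball-step T j x w xw (walk→ball T k≤j t r)

  ThinOutside : (Vertex n → Bool) → Set
  ThinOutside T = ∀ w → T w ≡ false → deg w ≤ 2

  module Layers (T : Vertex n → Bool) where

    layer : ℕ → Vertex n → Bool
    layer zero      = T
    layer (suc j) v = ball T (suc j) v ∧ not (ball T j v)

    not-true : ∀ {b} → not b ≡ true → b ≡ false
    not-true {false} _ = refl

    layer-outside : ∀ j v → layer (suc j) v ≡ true → T v ≡ false
    layer-outside j v h with T v in tv
    ... | false = refl
    ... | true  with trans (sym (ball-⊇ T j v tv)) (not-true (proj₂ (∧-elim _ _ h)))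
    ...   | ()

    layer-⊆-ball : ∀ j v → layer j v ≡ true → ball T j v ≡ true
    layer-⊆-ball zero    v h = h
    layer-⊆-ball (suc j) v h = proj₁ (∧-elim _ _ h)

    layer-of-nbr : ∀ j v w → adj G v w ≡ true → ball T j w ≡ true → not (ball T j v) ≡ true →
                   layer j w ≡ true
    layer-of-nbr zero     v w _  h _ = h
    layer-of-nbr (suc j′) v w vw h v-out with ball T j′ w in wj
    ... | false = cong (_∧ true) h
    ... | true  with trans (sym (ball-step T j′ v w vw wj)) (not-true v-out)
    ...   | ()

    layer-parent : ∀ j v → layer (suc j) v ≡ true → ∃[ w ] (adj G v w ≡ true × layer j w ≡ true)
    layer-parent j v h with ∧-elim _ _ h
    ... | in-ball , v-out with ∨-elim _ _ in-ball
    ...   | inj₁ earlier with trans (sym earlier) (not-true v-out)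
    ...     | ()
    layer-parent j v h | in-ball , v-out | inj₂ found =
      let w , e = anyV-elim n _ found
          vw , wj = ∧-elim _ _ e
      in w , vw , layer-of-nbr j v w vw wj v-out

    layer-beyond : ∀ j x → ball T (suc j) x ≡ true → layer (suc (suc j)) x ≡ false
    layer-beyond j x h rewrite h = refl

    ball-layers : ∀ j v → ⟦ ball T (suc j) v ⟧ ≡ ⟦ ball T j v ⟧ + ⟦ layer (suc j) v ⟧
    ball-layers j v with ball T j v
    ... | true  = refl
    ... | false with anyV n (λ w → adj G v w ∧ ball T j w)
    ...   | true  = refl
    ...   | false = refl

    -- Layer 1 consists of neighbours of T, so it has at most weight T vertices.
    first-layer : size (layer 1) ≤ weight T
    first-layer = ≤-trans (covering T (layer 1) (layer-parent 0))
                          (∑-mono n (λ w → *-monoʳ-≤ ⟦ T w ⟧ nbrs≤deg))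
      where
      nbrs≤deg : ∀ {w} → nbrs (layer 1) w ≤ deg w
      nbrs≤deg {w} = ≤-trans (m≤m+n _ _) (≤-reflexive (sym (deg-split (layer 1) w)))

    -- A thin vertex of layer j+1 spends one edge on layer j, so it has at most
    -- one neighbour in layer j+2; hence the layers do not grow.
    next-layer : ThinOutside T → ∀ j → size (layer (suc (suc j))) ≤ size (layer (suc j))
    next-layer thin j = ≤-trans (covering (layer (suc j)) Q (layer-parent (suc j))) (∑-mono n at-most-one)
      where
      Q = layer (suc (suc j))
      forward≤1 : ∀ w → layer (suc j) w ≡ true → nbrs Q w ≤ 1
      forward≤1 w lw =
        let x , wx , lx = layer-parent j w lw
            backward = nbrs-≥1 (not ∘ Q) w x wx
                         (cong not (layer-beyond j x (ball-suc T j x (layer-⊆-ball j x lx))))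
        in +-cancelʳ-≤ 1 _ _ (begin
             nbrs Q w + 1                     ≤⟨ +-monoʳ-≤ (nbrs Q w) backward ⟩
             nbrs Q w + nbrs (not ∘ Q) w      ≡⟨ sym (deg-split Q w) ⟩
             deg w                            ≤⟨ thin w (layer-outside j w lw) ⟩
             2                                ∎)
        where open ≤-Reasoning
      at-most-one : ∀ w → ⟦ layer (suc j) w ⟧ * nbrs Q w ≤ ⟦ layer (suc j) w ⟧
      at-most-one w with layer (suc j) w in lw
      ... | false = z≤n
      ... | true  = ≤-trans (≤-reflexive (+-identityʳ _)) (forward≤1 w lw)

    layer-size : ThinOutside T → ∀ j → size (layer (suc j)) ≤ weight T
    layer-size thin zero    = first-layer
    layer-size thin (suc j) = ≤-trans (next-layer thin j) (layer-size thin j)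

    ball-size : ThinOutside T → ∀ k → size (ball T k) ≤ size T + k * weight T
    ball-size thin zero    = ≤-reflexive (sym (+-identityʳ _))
    ball-size thin (suc k) = begin
        size (ball T (suc k))
      ≡⟨ ∑-cong n (ball-layers k) ⟩
        ∑ n (λ v → ⟦ ball T k v ⟧ + ⟦ layer (suc k) v ⟧)
      ≡⟨ ∑-+ n _ _ ⟩
        size (ball T k) + size (layer (suc k))
      ≤⟨ +-mono-≤ (ball-size thin k) (layer-size thin k) ⟩
        size T + k * weight T + weight T
      ≡⟨ +-assoc (size T) _ _ ⟩
        size T + (k * weight T + weight T)
      ≡⟨ cong (size T +_) (+-comm (k * weight T) (weight T)) ⟩
        size T + suc k * weight T
      ∎
      where open ≤-Reasoning

  -- In a graph of diameter ≤ n, breadth-first search from a nonempty T covers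
  -- the cube within n steps, so the cube has at most |T| + n·weight T vertices.
  cube-bound : DiameterAtMost n → ∀ T t → T t ≡ true → ThinOutside T →
               2 ^ n ≤ size T + n * weight T
  cube-bound D T t tt thin = begin
      2 ^ n            ≡⟨ sym (size-all n (ball T n) reaches) ⟩
      size (ball T n)  ≤⟨ Layers.ball-size T thin n ⟩
      size T + n * weight T ∎
    where
    open ≤-Reasoning
    reaches : ∀ v → ball T n v ≡ true
    reaches v = let _ , k≤n , W = D v t in walk→ball T k≤n tt W

  -- In dimension n ≥ 2 and diameter ≤ n, every vertex u has two neighbours:
  -- the walk from u to its antipode leaves through some w, and the walk from
  -- u to the antipode of w must leave through a different neighbour, since
  -- from w the antipode of w is at distance n.
  min-degree : 2 ≤ n → DiameterAtMost n → ∀ u → 2 ≤ deg u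
  min-degree n≥2 D u =
    let _ , _ , W      = D u (comp u)
        w , uw , _     = first-step W (subst (1 ≤_) (sym (ham-comp u)) n≥1)
        k , k≤n , W′   = D u (comp w)
        x , ux , W″    = first-step W′ (far w uw)
    in subst (_≤ deg u) (cong₂ (λ a b → ⟦ a ⟧ + ⟦ b ⟧) uw ux)
             (∑-≥-pair n _ w x (distinct w x k k≤n W″))
    where
    n≥1 : 1 ≤ n
    n≥1 = ≤-trans (s≤s z≤n) n≥2
    far : ∀ w → adj G u w ≡ true → 1 ≤ hamming u (comp w)
    far w uw = ≤-pred (≤-trans n≥2 (begin
        n                                  ≡⟨ sym (ham-comp w) ⟩
        hamming w (comp w)                 ≤⟨ ham-tri w u (comp w) ⟩
        hamming w u + hamming u (comp w)   ≡⟨ cong (_+ hamming u (comp w)) (trans (ham-sym w u) (sub G u w uw)) ⟩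
        suc (hamming u (comp w))           ∎))
      where open ≤-Reasoning
    distinct : ∀ w x k → k ≤ n → Walk G x (comp w) (pred k) → ¬ w ≡ x
    distinct w .w k k≤n W refl = <⇒≱ (≤-reflexive (suc-pred n {{>-nonZero n≥1}}))
      (≤-trans (subst (_≤ pred k) (ham-comp w) (walk-ham W)) (pred-mono-≤ k≤n))

  excess : ℕ
  excess = ∑ n (λ v → deg v ∸ 2)

  -- Since all degrees are at least 2, the degree sum is 2·2^n + excess.
  degree-sum : 2 ≤ n → DiameterAtMost n → ∑ n deg ≡ 2 * 2 ^ n + excess
  degree-sum n≥2 D = trans (∑-cong n (λ v → sym (m+[n∸m]≡n (min-degree n≥2 D v))))
                           (trans (∑-+ n _ _) (cong (_+ excess) (∑-const n 2)))

  handshake : orderedEdgeCount G ≡ ∑ n deg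
  handshake =
    trans (sum-concatMap (λ u → map (λ v → ⟦ adj G u v ⟧) (allVertices n)) (allVertices n))
          (trans (sym (∑-list n _)) (∑-cong n (λ u → sym (∑-list n _))))

  heavy : Vertex n → Bool
  heavy w = does (3 ≤? deg w)

  heavy-true : ∀ {w} → heavy w ≡ true → 3 ≤ deg w
  heavy-true {w} = from-dec (3 ≤? deg w)
    where
    from-dec : (d : Dec (3 ≤ deg w)) → does d ≡ true → 3 ≤ deg w
    from-dec (yes p) _ = p

  heavy-false : ∀ {w} → heavy w ≡ false → deg w ≤ 2
  heavy-false {w} = from-dec (3 ≤? deg w)
    where
    from-dec : (d : Dec (3 ≤ deg w)) → does d ≡ false → deg w ≤ 2
    from-dec (no ¬p) _ = ≤-pred (≰⇒> ¬p)

  -- Each heavy vertex contributes at least 1 to the excess ...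
  heavy-count : size heavy ≤ excess
  heavy-count = ∑-mono n pointwise
    where
    pointwise : ∀ v → ⟦ heavy v ⟧ ≤ deg v ∸ 2
    pointwise v = indicator-≤ (heavy v) (λ hv → ∸-monoˡ-≤ 2 (heavy-true hv))

  -- ... and its degree d is at most 3(d − 2).
  heavy-weight : weight heavy ≤ 3 * excess
  heavy-weight = ≤-trans (∑-mono n pointwise) (≤-reflexive (∑-* n 3 _))
    where
    large : ∀ d → 3 ≤ d → d ≤ 3 * (d ∸ 2)
    large (suc zero)          (s≤s ())
    large (suc (suc zero))    (s≤s (s≤s ()))
    large (suc (suc (suc e))) _ =
      ≤-trans (+-monoʳ-≤ 3 (m≤n*m e 3)) (≤-reflexive (sym (*-suc 3 e)))
    pointwise : ∀ v → ⟦ heavy v ⟧ * deg v ≤ 3 * (deg v ∸ 2)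
    pointwise v with heavy v in hv
    ... | false = z≤n
    ... | true  = ≤-trans (≤-reflexive (*-identityˡ _)) (large (deg v) (heavy-true hv))

  -- The key estimate: excess ≥ 2^n / 4n.  Heavy vertices exist, for otherwise
  -- breadth-first search from any single vertex covers at most 2n + 1 vertices.
  excess-bound : 1 ≤ n → 2 * n + 1 < 2 ^ n → DiameterAtMost n → 2 ^ n ≤ 4 * n * excess
  excess-bound n≥1 small D with anyV n heavy in any-heavy
  ... | true  = let s , hs = anyV-elim n heavy any-heavy in begin
      2 ^ n                               ≤⟨ cube-bound D heavy s hs (λ w → heavy-false) ⟩
      size heavy + n * weight heavy       ≤⟨ +-mono-≤ heavy-count (*-monoʳ-≤ n heavy-weight) ⟩
      excess + n * (3 * excess)           ≤⟨ +-monoˡ-≤ _ (m≤n*m excess n {{>-nonZero n≥1}}) ⟩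
      n * excess + n * (3 * excess)       ≡⟨ four-n n excess ⟩
      4 * n * excess                      ∎
    where
    open ≤-Reasoning
    four-n : ∀ n e → n * e + n * (3 * e) ≡ 4 * n * e
    four-n = solve-∀
  ... | false = ⊥-elim (<⇒≱ small (begin
      2 ^ n                                         ≤⟨ cube-bound D (point v) v (point-self v) all-thin ⟩
      size (point v) + n * weight (point v)         ≡⟨ cong (_+ n * weight (point v)) (size-point v) ⟩
      1 + n * weight (point v)                      ≤⟨ +-monoʳ-≤ 1 (*-monoʳ-≤ n weight≤2) ⟩
      1 + n * 2                                     ≡⟨ trans (+-comm 1 _) (cong (_+ 1) (*-comm n 2)) ⟩
      2 * n + 1                                     ∎))
    where
    open ≤-Reasoning
    v : Vertex n
    v = replicate n false
    thin : ∀ w → deg w ≤ 2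
    thin w with heavy w in hw
    ... | false = heavy-false hw
    ... | true  with trans (sym (anyV-intro n heavy w hw)) any-heavy
    ...   | ()
    all-thin : ThinOutside (point v)
    all-thin w _ = thin w
    weight≤2 : weight (point v) ≤ 2
    weight≤2 = begin
      weight (point v)                         ≤⟨ ∑-mono n (λ w → *-monoʳ-≤ ⟦ point v w ⟧ (thin w)) ⟩
      ∑ n (λ w → ⟦ point v w ⟧ * 2)            ≡⟨ ∑-cong n (λ w → *-comm ⟦ point v w ⟧ 2) ⟩
      ∑ n (λ w → 2 * ⟦ point v w ⟧)            ≡⟨ ∑-* n 2 (λ w → ⟦ point v w ⟧) ⟩
      2 * size (point v)                       ≡⟨ cong (2 *_) (size-point v) ⟩
      2                                        ∎

halve : ∀ m → m ≤ 1 + 2 * (m / 2)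
halve m = begin
  m                    ≡⟨ m≡m%n+[m/n]*n m 2 ⟩
  m % 2 + m / 2 * 2    ≤⟨ +-mono-≤ (≤-pred (m%n<n m 2)) (≤-reflexive (*-comm (m / 2) 2)) ⟩
  1 + 2 * (m / 2)      ∎
  where open ≤-Reasoning

2^n≥8n : ∀ {n} → 6 ≤ n → 8 * n ≤ 2 ^ n
2^n≥8n {n} n≥6 with m≤n⇒∃[o]m+o≡n n≥6
... | j , refl = grow j
  where
  grow : ∀ j → 8 * (6 + j) ≤ 2 ^ (6 + j)
  grow zero    = m≤m+n 48 16
  grow (suc j) = begin
    8 * (7 + j)                   ≡⟨ *-suc 8 (6 + j) ⟩
    8 + 8 * (6 + j)               ≤⟨ +-mono-≤ (≤-trans (m≤m*n 8 (6 + j)) (grow j)) (grow j) ⟩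
    2 ^ (6 + j) + 2 ^ (6 + j)     ≡⟨ cong (2 ^ (6 + j) +_) (sym (+-identityʳ _)) ⟩
    2 ^ (7 + j)                   ∎
    where open ≤-Reasoning

-- Linear comparison used to rule out graphs without heavy vertices.
2n+1<8n : ∀ {n} → 1 ≤ n → 2 * n + 1 < 8 * n
2n+1<8n {suc m} _ = subst (suc (2 * suc m + 1) ≤_) (identity m) (m≤m+n _ (4 + 6 * m))
  where
  identity : ∀ m → suc (2 * suc m + 1) + (4 + 6 * m) ≡ 8 * suc m
  identity = solve-∀

final-estimate : ∀ n P D E → 8 * n ≤ P → P ≤ 4 * n * D → 2 * P + D ≤ 1 + 2 * E →
                 16 * n * P + P ≤ 16 * n * E
final-estimate n P D E P≥8n P≤4nD 2P+D≤1+2E = *-cancelˡ-≤ 2 (+-cancelʳ-≤ (16 * n) _ _ (begin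
    2 * (16 * n * P + P) + 16 * n     ≡⟨ e₁ n P ⟩
    32 * n * P + 2 * P + 2 * (8 * n)  ≤⟨ +-monoʳ-≤ (32 * n * P + 2 * P) (*-monoʳ-≤ 2 P≥8n) ⟩
    32 * n * P + 2 * P + 2 * P        ≡⟨ e₂ n P ⟩
    32 * n * P + 4 * P                ≤⟨ +-monoʳ-≤ (32 * n * P) (*-monoʳ-≤ 4 P≤4nD) ⟩
    32 * n * P + 4 * (4 * n * D)      ≡⟨ e₃ n P D ⟩
    16 * n * (2 * P + D)              ≤⟨ *-monoʳ-≤ (16 * n) 2P+D≤1+2E ⟩
    16 * n * (1 + 2 * E)              ≡⟨ e₄ n E ⟩
    2 * (16 * n * E) + 16 * n         ∎))
  where
  open ≤-Reasoning
  e₁ : ∀ n P → 2 * (16 * n * P + P) + 16 * n ≡ 32 * n * P + 2 * P + 2 * (8 * n)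
  e₁ = solve-∀
  e₂ : ∀ n P → 32 * n * P + 2 * P + 2 * P ≡ 32 * n * P + 4 * P
  e₂ = solve-∀
  e₃ : ∀ n P D → 32 * n * P + 4 * (4 * n * D) ≡ 16 * n * (2 * P + D)
  e₃ = solve-∀
  e₄ : ∀ n E → 16 * n * (1 + 2 * E) ≡ 2 * (16 * n * E) + 16 * n
  e₄ = solve-∀

-- The theorem, with k = 16 and N = 6.
proposition4p1 : ∃[ k ] (1 ≤ k × ∃[ N ] (∀ (n : ℕ) → N ≤ n →
                   ∀ (G : SpanningSubgraph n) → HasDiameter G n →
                   k * n * 2 ^ n + 2 ^ n ≤ k * n * edges G))
proposition4p1 = 16 , s≤s z≤n , 6 , bound
  where
  bound : ∀ n → 6 ≤ n → ∀ (G : SpanningSubgraph n) → HasDiameter G n →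
          16 * n * 2 ^ n + 2 ^ n ≤ 16 * n * edges G
  bound n n≥6 G (D , _) = final-estimate n (2 ^ n) excess (edges G) P≥8n
    (excess-bound n≥1 (<-≤-trans (2n+1<8n n≥1) P≥8n) D)
    (subst (_≤ 1 + 2 * edges G) (trans handshake (degree-sum n≥2 D)) (halve (orderedEdgeCount G)))
    where
    open Graph G
    n≥2 : 2 ≤ n
    n≥2 = ≤-trans (s≤s (s≤s z≤n)) n≥6
    n≥1 : 1 ≤ n
    n≥1 = ≤-trans (s≤s z≤n) n≥2
    P≥8n : 8 * n ≤ 2 ^ n
    P≥8n = 2^n≥8n n≥6
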